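{- Let $h$ be a combinatorial presheaf. For all $a,b\in\mathcal G(h)$ the pattern functions satisfy $$\mathrm{p}_a\,\mathrm{p}_b=\sum_{c\in\mathcal G(h)}\binom{c}{a,b}\mathrm{p}_c$$ (pointwise product of functions $\mathcal G(h)\to\mathbb Q$, the sum having finitely many nonzero terms on each argument). In particular $\mathcal A(h)$ is a subalgebra of the algebra of functions $\mathcal G(h)\to\mathbb Q$ with pointwise multiplication, with unit $\sum_{c\in h[\emptyset]}\mathrm{p}_c$.
   Context: A combinatorial presheaf $h$ is a contravariant functor from the category of finite sets with injections to the category of finite sets: for each finite set $I$ a finite set $h[I]$, and for each injection $f:J\to I$ a map $h[f]:h[I]\to h[J]$, functorially. For $J\subseteq I$, $a|_J$ denotes the image of $a\in h[I]$ under the map induced by the inclusion. Objects $a\in h[I]$, $b\in h[J]$ are isomorphic ($a\sim b$) if some bijection $f:I\to J$ has $h[f](b)=a$. The set of coinvariants is $\mathcal G(h)=\biguplus_{n\ge0}h[[n]]/\sim$ with $[n]=\{1,\dots,n\}$. For objects $a$ and $b\in h[I]$, $\mathrm{p}_a(b)=|\{J'\subseteq I: b|_{J'}\sim a\}|$; this depends only on the isomorphism classes, so $\mathrm{p}_a$ for $a\in\mathcal G(h)$ is a function $\mathcal G(h)\to\mathbb Q$. $\mathcal A(h)$ is the $\mathbb Q$-linear span of $\{\mathrm{p}_a:a\in\mathcal G(h)\}$. For objects $a,b$ and $c\in h[C]$, the quasi-shuffle number is $\binom{c}{a,b}=|\{(I,J): I\cup J=C,\ c|_I\sim a,\ c|_J\sim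 b\}|$, which depends only on the isomorphism classes. -}

module Defs where

open import Data.Nat using (ℕ; zero; suc; _+_; _*_; _≤_)
open import Data.Fin using (Fin; zero; suc; _<_; toℕ; _≟_)
open import Data.Fin.Properties using (_<?_)
open import Data.Fin.Properties using (any?; all?; suc-injective)
open import Data.Fin.Subset using (Subset; _∪_; ⊤)
open import Data.Bool using (Bool; true; false)
import Data.Bool.Properties as BoolP
open import Data.Vec using (Vec; []; _∷_)
import Data.Vec.Properties as VecP
open import Data.List using (List; []; _∷_; _++_; map; filter; length; cartesianProduct; foldr)
open import Data.Product using (Σ; ∃; _×_; _,_; proj₁; proj₂)
open import Data.Integer using (+_)
open import Data.Rational using (ℚ; _/_; 0ℚ)
import Data.Rational as ℚ
open import Function using (_∘_; id)
open import Function.Definitions using (Injective)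
open import Relation.Nullary using (Dec; yes; no; ¬_; does)
open import Data.Bool using (if_then_else_)
open import Relation.Nullary.Decidable using (_×-dec_; ¬?; _→-dec_)
open import Relation.Binary.PropositionalEquality using (_≡_; refl; sym; trans; cong)

-- We work on the skeleton of the category of finite sets with injections:
-- the objects are the sets Fin m (= [m]), morphisms are injections
-- Fin m → Fin n.  A finite set h[[n]] is represented (up to bijection) by
-- Fin (obj n).

record Presheaf : Set where
  field
    obj    : ℕ → ℕ
    act    : ∀ {m n} (f : Fin m → Fin n) → .(Injective _≡_ _≡_ f) →
             Fin (obj n) → Fin (obj m)
    act-cong : ∀ {m n} {f g : Fin m → Fin n}
               .(pf : Injective _≡_ _≡_ f) .(pg : Injective _≡_ _≡_ g) →
               (∀ i → f i ≡ g i) → ∀ x → act f pf x ≡ act g pg x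
    act-id : ∀ {n} .(p : Injective _≡_ _≡_ (id {A = Fin n})) x →
             act id p x ≡ x
    act-∘  : ∀ {l m n} (f : Fin l → Fin m) (g : Fin m → Fin n)
             .(pf : Injective _≡_ _≡_ f) .(pg : Injective _≡_ _≡_ g)
             .(pgf : Injective _≡_ _≡_ (g ∘ f)) x →
             act (g ∘ f) pgf x ≡ act f pf (act g pg x)

card : ∀ {n} → Subset n → ℕ
card []          = zero
card (true ∷ S)  = suc (card S)
card (false ∷ S) = card S

emb : ∀ {n} (S : Subset n) → Fin (card S) → Fin n
emb (true ∷ S)  zero    = zero
emb (true ∷ S)  (suc i) = suc (emb S i)
emb (false ∷ S) i       = suc (emb S i)

emb-inj : ∀ {n} (S : Subset n) → Injective _≡_ _≡_ (emb S)
emb-inj (true ∷ S)  {zero}  {zero}  _  = refl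
emb-inj (true ∷ S)  {zero}  {suc _} ()
emb-inj (true ∷ S)  {suc _} {zero}  ()
emb-inj (true ∷ S)  {suc i} {suc j} eq = cong suc (emb-inj S (suc-injective eq))
emb-inj (false ∷ S) eq = emb-inj S (suc-injective eq)

allSubsets : ∀ n → List (Subset n)
allSubsets zero    = [] ∷ []
allSubsets (suc n) = map (true ∷_) (allSubsets n) ++ map (false ∷_) (allSubsets n)

finSum : ∀ n → (Fin n → ℕ) → ℕ
finSum zero    f = 0
finSum (suc n) f = f zero + finSum n (f ∘ suc)

cons : ∀ {m n} → Fin n → (Fin m → Fin n) → Fin (suc m) → Fin n
cons i f zero    = i
cons i f (suc k) = f k

∃fun? : ∀ m n (P : (Fin m → Fin n) → Set) →
        (∀ {f g} → (∀ x → f x ≡ g x) → P f → P g) →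
        (∀ f → Dec (P f)) → Dec (∃ P)
∃fun? zero n P resp P? with P? (λ ())
... | yes p = yes (_ , p)
... | no ¬p = no λ { (f , pf) → ¬p (resp (λ ()) pf) }
∃fun? (suc m) n P resp P?
  with any? (λ i → ∃fun? m n (λ f → P (cons i f))
                     (λ eq → resp (λ { zero → refl ; (suc k) → eq k }))
                     (λ f → P? (cons i f)))
... | yes (i , f , p) = yes (cons i f , p)
... | no ¬q = no λ { (f , pf) →
        ¬q (f zero , f ∘ suc , resp (λ { zero → refl ; (suc k) → refl }) pf) }

ℕ→ℚ : ℕ → ℚ
ℕ→ℚ n = + n / 1

module _ (h : Presheaf) where
  open Presheaf h

  Obj : Set
  Obj = Σ ℕ (λ n → Fin (obj n))

  inv⇒inj : ∀ {m n} {f : Fin m → Fin n} (g : Fin n → Fin m) →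
            (∀ x → g (f x) ≡ x) → Injective _≡_ _≡_ f
  inv⇒inj {f = f} g gf {x} {y} eq = trans (sym (gf x)) (trans (cong g eq) (gf y))

  Iso : Obj → Obj → Set
  Iso (m , a) (n , b) =
    Σ (Fin m → Fin n) λ f → Σ (Fin n → Fin m) λ g →
    Σ (∀ x → g (f x) ≡ x) λ gf → (∀ y → f (g y) ≡ y) × act f (inv⇒inj g gf) b ≡ a

  iso? : ∀ x y → Dec (Iso x y)
  iso? (m , a) (n , b) =
    ∃fun? m n _ respF (λ f → ∃fun? n m _ (respG f) (λ g → inner f g))
    where
    inner : ∀ (f : Fin m → Fin n) (g : Fin n → Fin m) →
            Dec (Σ (∀ x → g (f x) ≡ x) λ gf →
                 (∀ y → f (g y) ≡ y) × act f (inv⇒inj g gf) b ≡ a)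
    inner f g with all? (λ x → g (f x) ≟ x)
    ... | no ¬gf = no λ { (gf , _) → ¬gf gf }
    ... | yes gf with all? (λ y → f (g y) ≟ y) | act f (inv⇒inj g gf) b ≟ a
    ...   | yes fg | yes e = yes (gf , fg , e)
    ...   | no ¬fg | _     = no λ { (_ , fg , _) → ¬fg fg }
    ...   | _      | no ¬e = no λ { (_ , _ , e) → ¬e e }
    respG : ∀ f {g g'} → (∀ y → g y ≡ g' y) →
            (Σ (∀ x → g (f x) ≡ x) λ gf → (∀ y → f (g y) ≡ y) × act f (inv⇒inj g gf) b ≡ a) →
            (Σ (∀ x → g' (f x) ≡ x) λ gf → (∀ y → f (g' y) ≡ y) × act f (inv⇒inj g' gf) b ≡ a)
    respG f eq (gf , fg , e) =
      (λ x → trans (sym (eq (f x))) (gf x)) , (λ y → trans (cong f (sym (eq y))) (fg y)) , e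
    respF : ∀ {f f'} → (∀ x → f x ≡ f' x) →
            (∃ λ g → Σ (∀ x → g (f x) ≡ x) λ gf → (∀ y → f (g y) ≡ y) × act f (inv⇒inj g gf) b ≡ a) →
            (∃ λ g → Σ (∀ x → g (f' x) ≡ x) λ gf → (∀ y → f' (g y) ≡ y) × act f' (inv⇒inj g gf) b ≡ a)
    respF {f} {f'} eq (g , gf , fg , e) =
      g , (λ x → trans (cong g (sym (eq x))) (gf x)) , (λ y → trans (sym (eq (g y))) (fg y)) ,
      trans (sym (act-cong (inv⇒inj g gf) (inv⇒inj g (λ x → trans (cong g (sym (eq x))) (gf x))) eq b)) e

  restrict : ∀ {n} (S : Subset n) → Fin (obj n) → Obj
  restrict S b = card S , act (emb S) (emb-inj S) b

  pat : Obj → Obj → ℕ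
  pat a (n , b) = length (filter (λ S → iso? (restrict S b) a) (allSubsets n))

  qshuffle : Obj → Obj → Obj → ℕ
  qshuffle (n , c) a b =
    length (filter (λ IJ → (VecP.≡-dec BoolP._≟_ (proj₁ IJ ∪ proj₂ IJ) ⊤
                           ×-dec iso? (restrict (proj₁ IJ) c) a)
                           ×-dec iso? (restrict (proj₂ IJ) c) b)
             (cartesianProduct (allSubsets n) (allSubsets n)))

  -- c ∈ h[[k]] is the chosen representative of its class in G(h):
  -- it is the least element (w.r.t. the order of Fin (obj k)) of its class
  IsRep : ∀ k → Fin (obj k) → Set
  IsRep k c = ∀ (c' : Fin (obj k)) → c' < c → ¬ Iso (k , c') (k , c)

  isRep? : ∀ k c → Dec (IsRep k c)
  isRep? k c = all? (λ c' → c' <? c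
                 →-dec ¬? (iso? (k , c') (k , c)))

  -- Σ_{c ∈ G(h), |c| ≤ N} w(c): sum over representatives of classes of size ≤ N
  sumClasses≤ : ℕ → (Obj → ℕ) → ℕ
  sumClasses≤ N w = finSum (suc N) λ k →
    finSum (obj (toℕ k)) λ c →
      if does (isRep? (toℕ k) c) then w (toℕ k , c) else 0

  patℚ : Obj → Obj → ℚ
  patℚ a x = ℕ→ℚ (pat a x)

  evalLC : List (ℚ × Obj) → Obj → ℚ
  evalLC []            x = 0ℚ
  evalLC ((q , a) ∷ L) x = q ℚ.* patℚ a x ℚ.+ evalLC L x

  InA : (Obj → ℚ) → Set
  InA F = ∃ λ (L : List (ℚ × Obj)) → ∀ x → F x ≡ evalLC L x

{-# OPTIONS --safe #-}
-- p_a(d) · p_b(d) counts the pairs (S , T) of subsets of [n] with d|S ∼ a and d|T ∼ b.  Group them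
-- by U = S ∪ T: taking images and preimages along the increasing enumeration of U identifies the
-- pairs with union U with the pairs (I , J) that cover [|U|] and satisfy (d|U)|I ∼ a, (d|U)|J ∼ b,
-- so there are binom(d|U ; a, b) of them; the same transport along a bijection shows that
-- binom(c ; a, b) depends only on the class of c.  Grouping the subsets U by the class of d|U then
-- gives Σ_c binom(c ; a, b) p_c(d).  Since binom(c ; a, b) = 0 once |c| > |a| + |b|, p_a p_b is a
-- fixed finite combination of pattern functions, so A(h) is closed under products; and
-- Σ_{c ∈ h[∅]} p_c = 1 because every object has exactly one restriction to the empty set.
module Submission where

open import Defs
open import Algebra.Bundles using (CommutativeMonoid)
open import Data.Bool using (Bool; true; false; if_then_else_)
import Data.Bool.Properties as Bool
open import Data.Fin using (Fin; zero; suc; toℕ; fromℕ<; _≟_)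
import Data.Fin as Fin
open import Data.Fin.Properties
  using (suc-injective; toℕ-injective; toℕ-fromℕ<; cantor-schröder-bernstein; any?; <-cmp)
open import Data.Fin.Subset using (Subset; _∈_; _⊆_; _∪_; ⊤)
open import Data.Fin.Subset.Properties
  using (_∈?_; ⊆-antisym; ⊆⊤; ∈⊤; x∈p∪q⁺; x∈p∪q⁻; p⊆p∪q; q⊆p∪q)
open import Data.Integer using (1ℤ)
import Data.Integer as ℤ
import Data.Integer.Properties as ℤ
open import Data.List using (List; []; _∷_; _++_; map; filter; length; cartesianProduct)
open import Data.Nat using (ℕ; zero; suc; _+_; _*_; _≤_; _<_; z≤n; s≤s)
import Data.Nat as ℕ
open import Data.Nat.Properties
  using ( +-assoc; +-identityʳ; +-suc; *-assoc; *-comm; *-identityˡ; *-identityʳ; *-zeroʳ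
        ; *-distribˡ-+; ≤-reflexive; ≤-trans; +-monoʳ-≤; n≤1+n; m≤n⇒m≤1+n; m≤m+n; m≤n+m
        ; <⇒≱; 1+n≢0; +-commutativeSemigroup; module ≤-Reasoning )
open import Data.Product using (∃; _×_; _,_; proj₁; proj₂)
import Data.Product as Product
open import Data.Product.Properties using (×-≡,≡→≡; ×-≡,≡←≡)
open import Data.Rational using (ℚ; 1ℚ; toℚᵘ)
import Data.Rational as ℚ
import Data.Rational.Properties as ℚ
open import Data.Rational.Unnormalised using (ℚᵘ; mkℚᵘ; *≡*)
import Data.Rational.Unnormalised as ℚᵘ
import Data.Rational.Unnormalised.Properties as ℚᵘ
import Data.Sum as Sum
open import Data.Vec using ([]; _∷_; here; there; tabulate)
import Data.Vec.Properties as VecP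
open import Function using (id; _∘_; _⇔_; mk⇔)
open import Function.Definitions using (Injective)
open import Relation.Binary using (DecidableEquality; tri<; tri≈; tri>)
open import Relation.Binary.PropositionalEquality
open import Relation.Nullary using (Dec; yes; no; ¬_; does; contradiction)
open import Relation.Nullary.Decidable using (_×-dec_; map′; does-⇔; dec-true; dec-false)
open import Relation.Unary using (Pred; Decidable)

open import Algebra.Properties.CommutativeSemigroup +-commutativeSemigroup
  using (interchange)
open import Algebra.Properties.CommutativeSemigroup
  (CommutativeMonoid.commutativeSemigroup ℚ.*-1-commutativeMonoid)
  using (x∙yz≈y∙xz)

private
  variable
    A B : Set

∑ : List A → (A → ℕ) → ℕ
∑ []       f = 0
∑ (x ∷ xs) f = f x + ∑ xs f

∑-cong : ∀ (xs : List A) {f g : A → ℕ} → (∀ x → f x ≡ g x) → ∑ xs f ≡ ∑ xs g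
∑-cong []       f≗g = refl
∑-cong (x ∷ xs) f≗g = cong₂ _+_ (f≗g x) (∑-cong xs f≗g)

∑-zero : ∀ (xs : List A) {f : A → ℕ} → (∀ x → f x ≡ 0) → ∑ xs f ≡ 0
∑-zero []       f≗0 = refl
∑-zero (x ∷ xs) f≗0 = cong₂ _+_ (f≗0 x) (∑-zero xs f≗0)

∑-+ : ∀ (xs : List A) (f g : A → ℕ) → ∑ xs (λ x → f x + g x) ≡ ∑ xs f + ∑ xs g
∑-+ []       f g = refl
∑-+ (x ∷ xs) f g = trans (cong (f x + g x +_) (∑-+ xs f g)) (interchange (f x) (g x) _ _)

∑-*ˡ : ∀ (xs : List A) (c : ℕ) (f : A → ℕ) → ∑ xs (λ x → c * f x) ≡ c * ∑ xs f
∑-*ˡ []       c f = sym (*-zeroʳ c)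
∑-*ˡ (x ∷ xs) c f = trans (cong (c * f x +_) (∑-*ˡ xs c f)) (sym (*-distribˡ-+ c (f x) _))

∑-*ʳ : ∀ (xs : List A) (c : ℕ) (f : A → ℕ) → ∑ xs (λ x → f x * c) ≡ ∑ xs f * c
∑-*ʳ xs c f = begin
  ∑ xs (λ x → f x * c) ≡⟨ ∑-cong xs (λ x → *-comm (f x) c) ⟩
  ∑ xs (λ x → c * f x) ≡⟨ ∑-*ˡ xs c f ⟩
  c * ∑ xs f           ≡⟨ *-comm c _ ⟩
  ∑ xs f * c           ∎
  where open ≡-Reasoning

∑-++ : ∀ (xs ys : List A) (f : A → ℕ) → ∑ (xs ++ ys) f ≡ ∑ xs f + ∑ ys f
∑-++ []       ys f = refl
∑-++ (x ∷ xs) ys f = trans (cong (f x +_) (∑-++ xs ys f)) (sym (+-assoc (f x) _ _))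

∑-map : ∀ (g : A → B) (xs : List A) (f : B → ℕ) → ∑ (map g xs) f ≡ ∑ xs (f ∘ g)
∑-map g []       f = refl
∑-map g (x ∷ xs) f = cong (f (g x) +_) (∑-map g xs f)

∑-swap : ∀ (xs : List A) (ys : List B) (F : A → B → ℕ) →
         ∑ xs (λ x → ∑ ys (F x)) ≡ ∑ ys (λ y → ∑ xs (λ x → F x y))
∑-swap []       ys F = sym (∑-zero ys (λ _ → refl))
∑-swap (x ∷ xs) ys F =
  trans (cong (∑ ys (F x) +_) (∑-swap xs ys F)) (sym (∑-+ ys (F x) _))

∑-cartesianProduct : ∀ (xs : List A) (ys : List B) (F : A × B → ℕ) →
                     ∑ (cartesianProduct xs ys) F ≡ ∑ xs (λ x → ∑ ys (λ y → F (x , y)))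
∑-cartesianProduct []       ys F = refl
∑-cartesianProduct (x ∷ xs) ys F = begin
  ∑ (map (x ,_) ys ++ cartesianProduct xs ys) F
    ≡⟨ ∑-++ (map (x ,_) ys) _ F ⟩
  ∑ (map (x ,_) ys) F + ∑ (cartesianProduct xs ys) F
    ≡⟨ cong₂ _+_ (∑-map (x ,_) ys F) (∑-cartesianProduct xs ys F) ⟩
  ∑ ys (λ y → F (x , y)) + ∑ xs (λ x → ∑ ys (λ y → F (x , y))) ∎
  where open ≡-Reasoning

∑-*-∑ : ∀ (xs : List A) (ys : List B) (f : A → ℕ) (g : B → ℕ) →
        ∑ xs f * ∑ ys g ≡ ∑ (cartesianProduct xs ys) (λ p → f (proj₁ p) * g (proj₂ p))
∑-*-∑ xs ys f g = begin
  ∑ xs f * ∑ ys g                         ≡⟨ ∑-*ʳ xs (∑ ys g) f ⟨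
  ∑ xs (λ x → f x * ∑ ys g)               ≡⟨ ∑-cong xs (λ x → ∑-*ˡ ys (f x) g) ⟨
  ∑ xs (λ x → ∑ ys (λ y → f x * g y))     ≡⟨ ∑-cartesianProduct xs ys _ ⟨
  ∑ (cartesianProduct xs ys) (λ p → f (proj₁ p) * g (proj₂ p)) ∎
  where open ≡-Reasoning

if-∑ : ∀ (b : Bool) (xs : List A) (f : A → ℕ) →
       (if b then ∑ xs f else 0) ≡ ∑ xs (λ x → if b then f x else 0)
if-∑ true  xs f = refl
if-∑ false xs f = sym (∑-zero xs (λ _ → refl))

if-does-zero : {P : Set} (P? : Dec P) {n : ℕ} → (P → n ≡ 0) → (if does P? then n else 0) ≡ 0
if-does-zero (yes p) n≡0 = n≡0 p
if-does-zero (no _)  _   = refl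

if-* : ∀ (b : Bool) m n → (if b then m else 0) * n ≡ (if b then m * n else 0)
if-* true  m n = refl
if-* false m n = refl

χ : {P : Set} → Dec P → ℕ
χ P? = if does P? then 1 else 0

χ-yes : {P : Set} (P? : Dec P) → P → χ P? ≡ 1
χ-yes P? p = cong (if_then 1 else 0) (dec-true P? p)

χ-no : {P : Set} (P? : Dec P) → ¬ P → χ P? ≡ 0
χ-no P? ¬p = cong (if_then 1 else 0) (dec-false P? ¬p)

χ-⇔ : {P Q : Set} → P ⇔ Q → (P? : Dec P) (Q? : Dec Q) → χ P? ≡ χ Q?
χ-⇔ P⇔Q P? Q? = cong (if_then 1 else 0) (does-⇔ P⇔Q P? Q?)

χ-× : {P Q : Set} (P? : Dec P) (Q? : Dec Q) → χ (P? ×-dec Q?) ≡ χ P? * χ Q?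
χ-× (yes _) (yes _) = refl
χ-× (yes _) (no _)  = refl
χ-× (no _)  _       = refl

length-filter : {P : Pred A _} (P? : Decidable P) (xs : List A) →
                length (filter P? xs) ≡ ∑ xs (λ x → χ (P? x))
length-filter P? []       = refl
length-filter P? (x ∷ xs) with P? x
... | yes _ = cong suc (length-filter P? xs)
... | no  _ = length-filter P? xs

Enumerates : DecidableEquality A → List A → Set
Enumerates _≟_ xs = ∀ a → ∑ xs (λ x → χ (x ≟ a)) ≡ 1

-- Both sides count the pairs (x , y) with Q y and x ≡ from y.
∑-χ-reindex : {_≟ᴬ_ : DecidableEquality A} {_≟ᴮ_ : DecidableEquality B}
              (xs : List A) (ys : List B) → Enumerates _≟ᴬ_ xs → Enumerates _≟ᴮ_ ys →
              {P : Pred A _} (P? : Decidable P) {Q : Pred B _} (Q? : Decidable Q)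
              (from : B → A) (to : A → B) →
              (∀ {y} → Q y → P (from y)) → (∀ {x} → P x → Q (to x)) →
              (∀ {x} → P x → from (to x) ≡ x) → (∀ {y} → Q y → to (from y) ≡ y) →
              ∑ xs (λ x → χ (P? x)) ≡ ∑ ys (λ y → χ (Q? y))
∑-χ-reindex {_≟ᴬ_ = _≟ᴬ_} {_≟ᴮ_} xs ys enum-xs enum-ys {P} P? {Q} Q? from to Q⇒P P⇒Q from∘to to∘from =
  begin
  ∑ xs (λ x → χ (P? x))
    ≡⟨ ∑-cong xs fibre ⟩
  ∑ xs (λ x → ∑ ys (λ y → χ (Q? y) * χ (x ≟ᴬ from y)))
    ≡⟨ ∑-swap xs ys _ ⟩
  ∑ ys (λ y → ∑ xs (λ x → χ (Q? y) * χ (x ≟ᴬ from y)))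
    ≡⟨ ∑-cong ys (λ y → ∑-*ˡ xs (χ (Q? y)) _) ⟩
  ∑ ys (λ y → χ (Q? y) * ∑ xs (λ x → χ (x ≟ᴬ from y)))
    ≡⟨ ∑-cong ys (λ y → cong (χ (Q? y) *_) (enum-xs (from y))) ⟩
  ∑ ys (λ y → χ (Q? y) * 1)
    ≡⟨ ∑-cong ys (λ y → *-identityʳ _) ⟩
  ∑ ys (λ y → χ (Q? y)) ∎
  where
  open ≡-Reasoning

  fibre-of-P : ∀ {x} → P x → ∀ y → (Q y × x ≡ from y) ⇔ (y ≡ to x)
  fibre-of-P p y = mk⇔ (λ { (q , refl) → sym (to∘from q) })
                       (λ { refl → P⇒Q p , sym (from∘to p) })

  fibre : ∀ x → χ (P? x) ≡ ∑ ys (λ y → χ (Q? y) * χ (x ≟ᴬ from y))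
  fibre x with P? x
  ... | yes p = sym (begin
    ∑ ys (λ y → χ (Q? y) * χ (x ≟ᴬ from y))
      ≡⟨ ∑-cong ys (λ y → sym (χ-× (Q? y) (x ≟ᴬ from y))) ⟩
    ∑ ys (λ y → χ (Q? y ×-dec x ≟ᴬ from y))
      ≡⟨ ∑-cong ys (λ y → χ-⇔ (fibre-of-P p y) (Q? y ×-dec x ≟ᴬ from y) (y ≟ᴮ to x)) ⟩
    ∑ ys (λ y → χ (y ≟ᴮ to x))
      ≡⟨ enum-ys (to x) ⟩
    1 ∎)
  ... | no ¬p = sym (∑-zero ys (λ y →
    trans (sym (χ-× (Q? y) (x ≟ᴬ from y)))
          (χ-no (Q? y ×-dec x ≟ᴬ from y) (λ { (q , refl) → ¬p (Q⇒P q) }))))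

infix 4 _≟ˢ_
_≟ˢ_ : ∀ {n} → DecidableEquality (Subset n)
_≟ˢ_ = VecP.≡-dec Bool._≟_

-- Unlike Data.Product.Properties.≡-dec, the boolean of this decision is definitionally a conjunction.
×-≟ : DecidableEquality A → DecidableEquality B → DecidableEquality (A × B)
×-≟ _≟ᴬ_ _≟ᴮ_ p q = map′ ×-≡,≡→≡ ×-≡,≡←≡ (proj₁ p ≟ᴬ proj₁ q ×-dec proj₂ p ≟ᴮ proj₂ q)

allSubsets-enumerates : ∀ n → Enumerates _≟ˢ_ (allSubsets n)
allSubsets-enumerates zero    [] = refl
allSubsets-enumerates (suc n) (b ∷ a) = begin
  ∑ (map (true ∷_) Ss ++ map (false ∷_) Ss) (λ S → χ (S ≟ˢ (b ∷ a)))
    ≡⟨ ∑-++ (map (true ∷_) Ss) _ _ ⟩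
  ∑ (map (true ∷_) Ss) (λ S → χ (S ≟ˢ (b ∷ a))) + ∑ (map (false ∷_) Ss) (λ S → χ (S ≟ˢ (b ∷ a)))
    ≡⟨ cong₂ _+_ (head-counted true) (head-counted false) ⟩
  χ (true Bool.≟ b) + χ (false Bool.≟ b)
    ≡⟨ one-of b ⟩
  1 ∎
  where
  open ≡-Reasoning
  Ss : List (Subset n)
  Ss = allSubsets n

  head-counted : ∀ c → ∑ (map (c ∷_) Ss) (λ S → χ (S ≟ˢ (b ∷ a))) ≡ χ (c Bool.≟ b)
  head-counted c = begin
    ∑ (map (c ∷_) Ss) (λ S → χ (S ≟ˢ (b ∷ a)))  ≡⟨ ∑-map (c ∷_) Ss _ ⟩
    ∑ Ss (λ S → χ (c Bool.≟ b ×-dec S ≟ˢ a))     ≡⟨ ∑-cong Ss (λ S → χ-× (c Bool.≟ b) (S ≟ˢ a)) ⟩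
    ∑ Ss (λ S → χ (c Bool.≟ b) * χ (S ≟ˢ a))     ≡⟨ ∑-*ˡ Ss (χ (c Bool.≟ b)) _ ⟩
    χ (c Bool.≟ b) * ∑ Ss (λ S → χ (S ≟ˢ a))     ≡⟨ cong (χ (c Bool.≟ b) *_) (allSubsets-enumerates n a) ⟩
    χ (c Bool.≟ b) * 1                            ≡⟨ *-identityʳ _ ⟩
    χ (c Bool.≟ b)                                ∎

  one-of : ∀ b → χ (true Bool.≟ b) + χ (false Bool.≟ b) ≡ 1
  one-of true  = refl
  one-of false = refl

cartesianProduct-enumerates : {_≟ᴬ_ : DecidableEquality A} {_≟ᴮ_ : DecidableEquality B}
                              (xs : List A) (ys : List B) →
                              Enumerates _≟ᴬ_ xs → Enumerates _≟ᴮ_ ys →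
                              Enumerates (×-≟ _≟ᴬ_ _≟ᴮ_) (cartesianProduct xs ys)
cartesianProduct-enumerates {_≟ᴬ_ = _≟ᴬ_} {_≟ᴮ_} xs ys enum-xs enum-ys (a , b) = begin
  ∑ (cartesianProduct xs ys) (λ p → χ (proj₁ p ≟ᴬ a ×-dec proj₂ p ≟ᴮ b))
    ≡⟨ ∑-cong (cartesianProduct xs ys) (λ p → χ-× (proj₁ p ≟ᴬ a) (proj₂ p ≟ᴮ b)) ⟩
  ∑ (cartesianProduct xs ys) (λ p → χ (proj₁ p ≟ᴬ a) * χ (proj₂ p ≟ᴮ b))
    ≡⟨ ∑-*-∑ xs ys _ _ ⟨
  ∑ xs (λ x → χ (x ≟ᴬ a)) * ∑ ys (λ y → χ (y ≟ᴮ b))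
    ≡⟨ cong₂ _*_ (enum-xs a) (enum-ys b) ⟩
  1 ∎
  where open ≡-Reasoning

pairs : ∀ n → List (Subset n × Subset n)
pairs n = cartesianProduct (allSubsets n) (allSubsets n)

pairs-enumerate : ∀ n → Enumerates (×-≟ _≟ˢ_ _≟ˢ_) (pairs n)
pairs-enumerate n = cartesianProduct-enumerates {_≟ᴬ_ = _≟ˢ_} {_≟ᴮ_ = _≟ˢ_}
  (allSubsets n) (allSubsets n) (allSubsets-enumerates n) (allSubsets-enumerates n)

∃-least : ∀ {n} {P : Fin n → Set} → Decidable P → ∃ P → ∃ λ j → P j × (∀ i → i Fin.< j → ¬ P i)
∃-least {suc n} P? (i , Pi) with P? zero
∃-least {suc n} P? (i , Pi)     | yes P0 = zero , P0 , λ _ ()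
∃-least {suc n} P? (zero , P0)  | no ¬P0 = contradiction P0 ¬P0
∃-least {suc n} P? (suc i , Pi) | no ¬P0 with ∃-least (P? ∘ suc) (i , Pi)
... | j , Pj , below = suc j , Pj , λ { zero _ → ¬P0 ; (suc i) (s≤s i<j) → below i i<j }

finSum-cong : ∀ n {f g : Fin n → ℕ} → (∀ i → f i ≡ g i) → finSum n f ≡ finSum n g
finSum-cong zero    f≗g = refl
finSum-cong (suc n) f≗g = cong₂ _+_ (f≗g zero) (finSum-cong n (f≗g ∘ suc))

finSum-zero : ∀ n {f : Fin n → ℕ} → (∀ i → f i ≡ 0) → finSum n f ≡ 0
finSum-zero zero    f≗0 = refl
finSum-zero (suc n) f≗0 = cong₂ _+_ (f≗0 zero) (finSum-zero n (f≗0 ∘ suc))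

finSum-single : ∀ n (f : Fin n → ℕ) (j : Fin n) → (∀ i → i ≢ j → f i ≡ 0) → finSum n f ≡ f j
finSum-single (suc n) f zero    f≗0 =
  trans (cong (f zero +_) (finSum-zero n (λ i → f≗0 (suc i) (λ ())))) (+-identityʳ _)
finSum-single (suc n) f (suc j) f≗0 =
  trans (cong (_+ finSum n (f ∘ suc)) (f≗0 zero (λ ())))
        (finSum-single n (f ∘ suc) j (λ i i≢j → f≗0 (suc i) (i≢j ∘ suc-injective)))

finSum-∑ : ∀ n (xs : List A) (F : Fin n → A → ℕ) →
           finSum n (λ i → ∑ xs (F i)) ≡ ∑ xs (λ x → finSum n (λ i → F i x))
finSum-∑ zero    xs F = sym (∑-zero xs (λ _ → refl))
finSum-∑ (suc n) xs F =
  trans (cong (∑ xs (F zero) +_) (finSum-∑ n xs (F ∘ suc))) (sym (∑-+ xs (F zero) _))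

finSum-toℕ-single : ∀ n (H : ℕ → ℕ) m → m < n → (∀ k → k ≢ m → H k ≡ 0) →
                    finSum n (H ∘ toℕ) ≡ H m
finSum-toℕ-single n H m m<n H≗0 =
  trans (finSum-single n (H ∘ toℕ) (fromℕ< m<n) vanish) (cong H (toℕ-fromℕ< m<n))
  where
  vanish : ∀ i → i ≢ fromℕ< m<n → H (toℕ i) ≡ 0
  vanish i i≢ = H≗0 (toℕ i) (λ i≡m → i≢ (toℕ-injective (trans i≡m (sym (toℕ-fromℕ< m<n)))))

finSum-toℕ-truncate : ∀ M N (H : ℕ → ℕ) → M ≤ N → (∀ k → M < k → H k ≡ 0) →
                      finSum (suc N) (H ∘ toℕ) ≡ finSum (suc M) (H ∘ toℕ)
finSum-toℕ-truncate zero    N       H M≤N H≗0 =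
  cong (H 0 +_) (finSum-zero N (λ i → H≗0 (suc (toℕ i)) (s≤s z≤n)))
finSum-toℕ-truncate (suc M) (suc N) H (s≤s M≤N) H≗0 =
  cong (H 0 +_) (finSum-toℕ-truncate M N (H ∘ suc) M≤N (λ k M<k → H≗0 (suc k) (s≤s M<k)))

emb-∈ : ∀ {n} (S : Subset n) i → emb S i ∈ S
emb-∈ (true ∷ S)  zero    = here
emb-∈ (true ∷ S)  (suc i) = there (emb-∈ S i)
emb-∈ (false ∷ S) i       = there (emb-∈ S i)

∈⇒emb : ∀ {n} (S : Subset n) {x} → x ∈ S → ∃ λ i → emb S i ≡ x
∈⇒emb (true ∷ S)  here        = zero , refl
∈⇒emb (true ∷ S)  (there x∈S) = Product.map suc (cong suc) (∈⇒emb S x∈S)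
∈⇒emb (false ∷ S) (there x∈S) = Product.map₂ (cong suc) (∈⇒emb S x∈S)

card-≤ : ∀ {n} (S : Subset n) → card S ≤ n
card-≤ []          = z≤n
card-≤ (true ∷ S)  = s≤s (card-≤ S)
card-≤ (false ∷ S) = m≤n⇒m≤1+n (card-≤ S)

card-⊤ : ∀ n → card (⊤ {n}) ≡ n
card-⊤ zero    = refl
card-⊤ (suc n) = cong suc (card-⊤ n)

card-∪ : ∀ {n} (S T : Subset n) → card (S ∪ T) ≤ card S + card T
card-∪ []          []          = z≤n
card-∪ (true ∷ S)  (true ∷ T)  = s≤s (≤-trans (card-∪ S T) (+-monoʳ-≤ (card S) (n≤1+n _)))
card-∪ (true ∷ S)  (false ∷ T) = s≤s (card-∪ S T)
card-∪ (false ∷ S) (true ∷ T)  = ≤-trans (s≤s (card-∪ S T)) (≤-reflexive (sym (+-suc (card S) (card T))))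
card-∪ (false ∷ S) (false ∷ T) = card-∪ S T

∈-tabulate⁺ : ∀ {n} {P : Fin n → Set} (P? : Decidable P) {x} → P x → x ∈ tabulate (λ y → does (P? y))
∈-tabulate⁺ P? {x} px =
  VecP.lookup⇒[]= x _ (trans (VecP.lookup∘tabulate (λ y → does (P? y)) x) (dec-true (P? x) px))

∈-tabulate⁻ : ∀ {n} {P : Fin n → Set} (P? : Decidable P) {x} → x ∈ tabulate (λ y → does (P? y)) → P x
∈-tabulate⁻ P? {x} x∈
  with P? x | trans (sym (VecP.lookup∘tabulate (λ y → does (P? y)) x)) (VecP.[]=⇒lookup x∈)
... | yes px | _  = px
... | no  _  | ()

∑-χ-card≡0 : ∀ n → ∑ (allSubsets n) (λ S → χ (card S ℕ.≟ 0)) ≡ 1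
∑-χ-card≡0 zero    = refl
∑-χ-card≡0 (suc n) = trans (∑-++ (map (true ∷_) Ss) (map (false ∷_) Ss) _) (cong₂ _+_
  (trans (∑-map (true ∷_) Ss _) (∑-zero Ss (λ _ → refl)))
  (trans (∑-map (false ∷_) Ss _) (∑-χ-card≡0 n)))
  where
  Ss : List (Subset n)
  Ss = allSubsets n

ℕ→ℚᵘ : ℕ → ℚᵘ
ℕ→ℚᵘ n = mkℚᵘ (ℤ.+ n) 0

toℚᵘ-ℕ→ℚ : ∀ n → toℚᵘ (ℕ→ℚ n) ℚᵘ.≃ ℕ→ℚᵘ n
toℚᵘ-ℕ→ℚ n = ℚ.toℚᵘ-fromℚᵘ (ℕ→ℚᵘ n)

ℕ→ℚᵘ-+ : ∀ m n → ℕ→ℚᵘ (m + n) ℚᵘ.≃ ℕ→ℚᵘ m ℚᵘ.+ ℕ→ℚᵘ n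
ℕ→ℚᵘ-+ m n = *≡* (begin
  ℤ.+ (m + n) ℤ.* 1ℤ                      ≡⟨ ℤ.*-identityʳ _ ⟩
  ℤ.+ (m + n)                             ≡⟨ ℤ.pos-+ m n ⟩
  ℤ.+ m ℤ.+ ℤ.+ n                         ≡⟨ cong₂ ℤ._+_ (ℤ.*-identityʳ (ℤ.+ m)) (ℤ.*-identityʳ (ℤ.+ n)) ⟨
  ℤ.+ m ℤ.* 1ℤ ℤ.+ ℤ.+ n ℤ.* 1ℤ           ≡⟨ ℤ.*-identityʳ _ ⟨
  (ℤ.+ m ℤ.* 1ℤ ℤ.+ ℤ.+ n ℤ.* 1ℤ) ℤ.* 1ℤ  ∎)
  where open ≡-Reasoning

ℕ→ℚᵘ-* : ∀ m n → ℕ→ℚᵘ (m * n) ℚᵘ.≃ ℕ→ℚᵘ m ℚᵘ.* ℕ→ℚᵘ n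
ℕ→ℚᵘ-* m n = *≡* (cong (ℤ._* 1ℤ) (ℤ.pos-* m n))

ℕ→ℚ-+ : ∀ m n → ℕ→ℚ (m + n) ≡ ℕ→ℚ m ℚ.+ ℕ→ℚ n
ℕ→ℚ-+ m n = ℚ.toℚᵘ-injective (begin
  toℚᵘ (ℕ→ℚ (m + n))              ≈⟨ toℚᵘ-ℕ→ℚ (m + n) ⟩
  ℕ→ℚᵘ (m + n)                     ≈⟨ ℕ→ℚᵘ-+ m n ⟩
  ℕ→ℚᵘ m ℚᵘ.+ ℕ→ℚᵘ n               ≈⟨ ℚᵘ.+-cong (toℚᵘ-ℕ→ℚ m) (toℚᵘ-ℕ→ℚ n) ⟨
  toℚᵘ (ℕ→ℚ m) ℚᵘ.+ toℚᵘ (ℕ→ℚ n)   ≈⟨ ℚ.toℚᵘ-homo-+ (ℕ→ℚ m) (ℕ→ℚ n) ⟨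
  toℚᵘ (ℕ→ℚ m ℚ.+ ℕ→ℚ n)           ∎)
  where open ℚᵘ.≃-Reasoning

ℕ→ℚ-* : ∀ m n → ℕ→ℚ (m * n) ≡ ℕ→ℚ m ℚ.* ℕ→ℚ n
ℕ→ℚ-* m n = ℚ.toℚᵘ-injective (begin
  toℚᵘ (ℕ→ℚ (m * n))              ≈⟨ toℚᵘ-ℕ→ℚ (m * n) ⟩
  ℕ→ℚᵘ (m * n)                     ≈⟨ ℕ→ℚᵘ-* m n ⟩
  ℕ→ℚᵘ m ℚᵘ.* ℕ→ℚᵘ n               ≈⟨ ℚᵘ.*-cong (toℚᵘ-ℕ→ℚ m) (toℚᵘ-ℕ→ℚ n) ⟨
  toℚᵘ (ℕ→ℚ m) ℚᵘ.* toℚᵘ (ℕ→ℚ n)   ≈⟨ ℚ.toℚᵘ-homo-* (ℕ→ℚ m) (ℕ→ℚ n) ⟨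
  toℚᵘ (ℕ→ℚ m ℚ.* ℕ→ℚ n)           ∎)
  where open ℚᵘ.≃-Reasoning

module _ (h : Presheaf) where
  open Presheaf h

  infix 4 _∼_
  _∼_ : Obj h → Obj h → Set
  _∼_ = Iso h

  ∼-refl : ∀ {x} → x ∼ x
  ∼-refl {m , a} = id , id , (λ _ → refl) , (λ _ → refl) , act-id _ a

  ∼-sym : ∀ {x y} → x ∼ y → y ∼ x
  ∼-sym {m , a} {n , b} (f , g , g∘f , f∘g , fb≡a) = g , f , f∘g , g∘f , (begin
    act g _ a            ≡⟨ cong (act g _) fb≡a ⟨
    act g _ (act f _ b)  ≡⟨ act-∘ g f _ _ (inv⇒inj h id f∘g) b ⟨
    act (f ∘ g) _ b      ≡⟨ act-cong _ (inv⇒inj h id (λ _ → refl)) f∘g b ⟩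
    act id _ b           ≡⟨ act-id _ b ⟩
    b                    ∎)
    where open ≡-Reasoning

  ∼-trans : ∀ {x y z} → x ∼ y → y ∼ z → x ∼ z
  ∼-trans {l , a} {m , b} {n , c} (f , g , g∘f , f∘g , fb≡a) (f′ , g′ , g′∘f′ , f′∘g′ , f′c≡b) =
    f′ ∘ f , g ∘ g′ ,
    (λ x → trans (cong g (g′∘f′ (f x))) (g∘f x)) ,
    (λ y → trans (cong f′ (f∘g (g′ y))) (f′∘g′ y)) ,
    (begin
      act (f′ ∘ f) _ c      ≡⟨ act-∘ f f′ _ _ _ c ⟩
      act f _ (act f′ _ c)  ≡⟨ cong (act f _) f′c≡b ⟩
      act f _ b             ≡⟨ fb≡a ⟩
      a                     ∎)
    where open ≡-Reasoning

  ∼-size : ∀ {x y} → x ∼ y → proj₁ x ≡ proj₁ y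
  ∼-size (f , g , g∘f , f∘g , _) = cantor-schröder-bernstein (inv⇒inj h g g∘f) (inv⇒inj h f f∘g)

  ∼-empty : ∀ {y c} → (0 , y) ∼ (0 , c) → y ≡ c
  ∼-empty {y} {c} (f , g , g∘f , _ , fc≡y) =
    trans (sym fc≡y) (trans (act-cong _ (inv⇒inj h id (λ _ → refl)) (λ ()) c) (act-id _ c))

  ∼-same-image : ∀ {m m′ n} (f : Fin m → Fin n) (g : Fin m′ → Fin n)
                 (f-inj : Injective _≡_ _≡_ f) (g-inj : Injective _≡_ _≡_ g) →
                 (∀ i → ∃ λ j → g j ≡ f i) → (∀ j → ∃ λ i → f i ≡ g j) →
                 ∀ e → (m , act f f-inj e) ∼ (m′ , act g g-inj e)
  ∼-same-image {m} {m′} f g f-inj g-inj f⊆g g⊆f e = φ , ψ , ψ∘φ , φ∘ψ , (begin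
    act φ _ (act g g-inj e)  ≡⟨ act-∘ φ g _ g-inj g∘φ-inj e ⟨
    act (g ∘ φ) _ e          ≡⟨ act-cong g∘φ-inj f-inj (proj₂ ∘ f⊆g) e ⟩
    act f f-inj e            ∎)
    where
    open ≡-Reasoning
    φ : Fin m → Fin m′
    φ = proj₁ ∘ f⊆g
    ψ : Fin m′ → Fin m
    ψ = proj₁ ∘ g⊆f
    ψ∘φ : ∀ i → ψ (φ i) ≡ i
    ψ∘φ i = f-inj (trans (proj₂ (g⊆f (φ i))) (proj₂ (f⊆g i)))
    φ∘ψ : ∀ j → φ (ψ j) ≡ j
    φ∘ψ j = g-inj (trans (proj₂ (f⊆g (ψ j))) (proj₂ (g⊆f j)))
    g∘φ-inj : Injective _≡_ _≡_ (g ∘ φ)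
    g∘φ-inj = inv⇒inj h ψ ψ∘φ ∘ g-inj

  -- Quasi-shuffles and transport along injections

  Covers : ∀ {n} → Subset n → Fin (obj n) → Obj h → Obj h → Subset n × Subset n → Set
  Covers U e a b IJ =
    ((proj₁ IJ ∪ proj₂ IJ ≡ U) × restrict h (proj₁ IJ) e ∼ a) × restrict h (proj₂ IJ) e ∼ b

  -- For U = ⊤ this is verbatim the predicate counted by qshuffle.
  covers? : ∀ {n} (U : Subset n) e a b → Decidable (Covers U e a b)
  covers? U e a b IJ = (proj₁ IJ ∪ proj₂ IJ ≟ˢ U ×-dec iso? h (restrict h (proj₁ IJ) e) a)
                       ×-dec iso? h (restrict h (proj₂ IJ) e) b

  qshuffle-as-∑ : ∀ {n} (e : Fin (obj n)) a b →
                  qshuffle h (n , e) a b ≡ ∑ (pairs n) (λ IJ → χ (covers? ⊤ e a b IJ))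
  qshuffle-as-∑ {n} e a b = length-filter (covers? ⊤ e a b) (pairs n)

  module Transport {k n} (F : Fin k → Fin n) (F-inj : Injective _≡_ _≡_ F) (U : Subset n)
                   (F-∈ : ∀ i → F i ∈ U) (∈⇒F : ∀ {x} → x ∈ U → ∃ λ i → F i ≡ x) where

    preimage : Subset n → Subset k
    preimage S = tabulate (λ i → does (F i ∈? S))

    image : Subset k → Subset n
    image S′ = tabulate (λ x → does (any? (λ i → i ∈? S′ ×-dec F i ≟ x)))

    ∈-preimage⁺ : ∀ {S i} → F i ∈ S → i ∈ preimage S
    ∈-preimage⁺ {S} = ∈-tabulate⁺ (λ i → F i ∈? S)

    ∈-preimage⁻ : ∀ {S i} → i ∈ preimage S → F i ∈ S
    ∈-preimage⁻ {S} = ∈-tabulate⁻ (λ i → F i ∈? S)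

    ∈-image⁺ : ∀ {S′ i} → i ∈ S′ → F i ∈ image S′
    ∈-image⁺ {S′} {i} i∈S′ = ∈-tabulate⁺ (λ x → any? (λ i → i ∈? S′ ×-dec F i ≟ x)) (i , i∈S′ , refl)

    ∈-image⁻ : ∀ {S′ x} → x ∈ image S′ → ∃ λ i → i ∈ S′ × F i ≡ x
    ∈-image⁻ {S′} = ∈-tabulate⁻ (λ x → any? (λ i → i ∈? S′ ×-dec F i ≟ x))

    preimage-image : ∀ S′ → preimage (image S′) ≡ S′
    preimage-image S′ = ⊆-antisym (λ i∈ → from (∈-image⁻ (∈-preimage⁻ i∈))) (∈-preimage⁺ ∘ ∈-image⁺)
      where
      from : ∀ {i} → (∃ λ j → j ∈ S′ × F j ≡ F i) → i ∈ S′
      from (j , j∈S′ , Fj≡Fi) = subst (_∈ S′) (F-inj Fj≡Fi) j∈S′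

    image-preimage : ∀ {S} → S ⊆ U → image (preimage S) ≡ S
    image-preimage {S} S⊆U = ⊆-antisym (λ x∈ → to (∈-image⁻ x∈)) (λ x∈S → from x∈S (∈⇒F (S⊆U x∈S)))
      where
      to : ∀ {x} → (∃ λ i → i ∈ preimage S × F i ≡ x) → x ∈ S
      to (i , i∈ , refl) = ∈-preimage⁻ i∈
      from : ∀ {x} → x ∈ S → (∃ λ i → F i ≡ x) → x ∈ image (preimage S)
      from x∈S (i , refl) = ∈-image⁺ (∈-preimage⁺ x∈S)

    preimage-∪ : ∀ {S T} → S ∪ T ≡ U → preimage S ∪ preimage T ≡ ⊤
    preimage-∪ {S} {T} refl = ⊆-antisym ⊆⊤ (λ {i} _ →
      x∈p∪q⁺ (Sum.map ∈-preimage⁺ ∈-preimage⁺ (x∈p∪q⁻ S T (F-∈ i))))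

    image-∪ : ∀ {S′ T′} → S′ ∪ T′ ≡ ⊤ → image S′ ∪ image T′ ≡ U
    image-∪ {S′} {T′} S′∪T′≡⊤ = ⊆-antisym to (λ x∈U → from (∈⇒F x∈U))
      where
      in-U : ∀ {V x} → (∃ λ i → i ∈ V × F i ≡ x) → x ∈ U
      in-U (i , _ , refl) = F-∈ i
      to : image S′ ∪ image T′ ⊆ U
      to x∈ = Sum.[ in-U ∘ ∈-image⁻ , in-U ∘ ∈-image⁻ ]′ (x∈p∪q⁻ (image S′) (image T′) x∈)
      from : ∀ {x} → (∃ λ i → F i ≡ x) → x ∈ image S′ ∪ image T′
      from (i , refl) = x∈p∪q⁺ (Sum.map ∈-image⁺ ∈-image⁺
                          (x∈p∪q⁻ S′ T′ (subst (i ∈_) (sym S′∪T′≡⊤) ∈⊤)))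

    module _ (e : Fin (obj n)) where

      restrict-image : ∀ S′ → restrict h S′ (act F F-inj e) ∼ restrict h (image S′) e
      restrict-image S′ =
        subst (λ c → (card S′ , c) ∼ restrict h (image S′) e) (act-∘ (emb S′) F _ F-inj _ e)
              (∼-same-image (F ∘ emb S′) (emb (image S′)) (emb-inj S′ ∘ F-inj) (emb-inj (image S′))
                            in-image in-S′ e)
        where
        in-image : ∀ i → ∃ λ j → emb (image S′) j ≡ F (emb S′ i)
        in-image i = ∈⇒emb (image S′) (∈-image⁺ (emb-∈ S′ i))
        in-S′ : ∀ j → ∃ λ i → F (emb S′ i) ≡ emb (image S′) j
        in-S′ j with ∈-image⁻ (emb-∈ (image S′) j)
        ... | i′ , i′∈S′ , Fi′≡ = Product.map₂ (λ emb≡i′ → trans (cong F emb≡i′) Fi′≡) (∈⇒emb S′ i′∈S′)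

      restrict-preimage : ∀ {S} → S ⊆ U → restrict h (preimage S) (act F F-inj e) ∼ restrict h S e
      restrict-preimage {S} S⊆U =
        subst (λ V → restrict h (preimage S) (act F F-inj e) ∼ restrict h V e) (image-preimage S⊆U)
              (restrict-image (preimage S))

      ∑-covers : ∀ a b → ∑ (pairs n) (λ IJ → χ (covers? U e a b IJ)) ≡ qshuffle h (k , act F F-inj e) a b
      ∑-covers a b = sym (trans (qshuffle-as-∑ c a b)
        (∑-χ-reindex {_≟ᴬ_ = ×-≟ _≟ˢ_ _≟ˢ_} {_≟ᴮ_ = ×-≟ _≟ˢ_ _≟ˢ_}
                     (pairs k) (pairs n) (pairs-enumerate k) (pairs-enumerate n)
                     (covers? ⊤ c a b) (covers? U e a b)
                     (Product.map preimage preimage) (Product.map image image)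
                     pull push (λ _ → ×-≡,≡→≡ (preimage-image _ , preimage-image _)) image∘preimage))
        where
        c : Fin (obj k)
        c = act F F-inj e
        pull : ∀ {IJ} → Covers U e a b IJ → Covers ⊤ c a b (preimage (proj₁ IJ) , preimage (proj₂ IJ))
        pull {S , T} ((refl , S∼a) , T∼b) =
          (preimage-∪ refl , ∼-trans (restrict-preimage (p⊆p∪q T)) S∼a) ,
          ∼-trans (restrict-preimage (q⊆p∪q S T)) T∼b
        push : ∀ {IJ} → Covers ⊤ c a b IJ → Covers U e a b (image (proj₁ IJ) , image (proj₂ IJ))
        push {S′ , T′} ((∪≡⊤ , S′∼a) , T′∼b) =
          (image-∪ ∪≡⊤ , ∼-trans (∼-sym (restrict-image S′)) S′∼a) ,
          ∼-trans (∼-sym (restrict-image T′)) T′∼b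
        image∘preimage : ∀ {IJ} → Covers U e a b IJ →
                         (image (preimage (proj₁ IJ)) , image (preimage (proj₂ IJ))) ≡ IJ
        image∘preimage {S , T} ((refl , _) , _) =
          ×-≡,≡→≡ (image-preimage (p⊆p∪q T) , image-preimage (q⊆p∪q S T))

  qshuffle-∼ : ∀ {x y} a b → x ∼ y → qshuffle h x a b ≡ qshuffle h y a b
  qshuffle-∼ {m , u} {n , v} a b (f , g , g∘f , f∘g , fv≡u) = begin
    qshuffle h (m , u) a b                          ≡⟨ cong (λ w → qshuffle h (m , w) a b) fv≡u ⟨
    qshuffle h (m , act f _ v) a b                  ≡⟨ T.∑-covers v a b ⟨
    ∑ (pairs n) (λ IJ → χ (covers? ⊤ v a b IJ))    ≡⟨ qshuffle-as-∑ v a b ⟨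
    qshuffle h (n , v) a b                          ∎
    where
    open ≡-Reasoning
    module T = Transport f (inv⇒inj h g g∘f) ⊤ (λ _ → ∈⊤) (λ {x} _ → g x , f∘g x)

  ∑-covers-restrict : ∀ {n} (U : Subset n) e a b →
                      ∑ (pairs n) (λ IJ → χ (covers? U e a b IJ)) ≡ qshuffle h (restrict h U e) a b
  ∑-covers-restrict U = Transport.∑-covers (emb U) (emb-inj U) U (emb-∈ U) (∈⇒emb U)

  qshuffle-vanishes : ∀ {k} (c : Fin (obj k)) a b → proj₁ a + proj₁ b < k → qshuffle h (k , c) a b ≡ 0
  qshuffle-vanishes {k} c a b a+b<k =
    trans (qshuffle-as-∑ c a b) (∑-zero (pairs k) (λ IJ → χ-no (covers? ⊤ c a b IJ) (too-large IJ)))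
    where
    too-large : ∀ IJ → ¬ Covers ⊤ c a b IJ
    too-large (I , J) ((I∪J≡⊤ , I∼a) , J∼b) = <⇒≱ a+b<k (begin
      k                ≡⟨ card-⊤ k ⟨
      card (⊤ {k})     ≡⟨ cong card I∪J≡⊤ ⟨
      card (I ∪ J)     ≤⟨ card-∪ I J ⟩
      card I + card J  ≡⟨ cong₂ _+_ (∼-size I∼a) (∼-size J∼b) ⟩
      proj₁ a + proj₁ b ∎)
      where open ≤-Reasoning

  -- Sums over isomorphism classes

  sumClassesOfSize : ℕ → (Obj h → ℕ) → ℕ
  sumClassesOfSize m w = finSum (obj m) (λ c → if does (isRep? h m c) then w (m , c) else 0)

  sumClasses≤-cong : ∀ N {w w′ : Obj h → ℕ} → (∀ c → w c ≡ w′ c) → sumClasses≤ h N w ≡ sumClasses≤ h N w′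
  sumClasses≤-cong N w≗w′ = finSum-cong (suc N) (λ k → finSum-cong (obj (toℕ k)) (λ c →
    cong (if does (isRep? h (toℕ k) c) then_else 0) (w≗w′ (toℕ k , c))))

  sumClassesOfSize-∑ : ∀ m (xs : List A) (F : Obj h → A → ℕ) →
                       sumClassesOfSize m (λ c → ∑ xs (F c))
                       ≡ ∑ xs (λ x → sumClassesOfSize m (λ c → F c x))
  sumClassesOfSize-∑ m xs F = trans
    (finSum-cong (obj m) (λ c → if-∑ (does (isRep? h m c)) xs (F (m , c))))
    (finSum-∑ (obj m) xs (λ c x → if does (isRep? h m c) then F (m , c) x else 0))

  sumClasses≤-∑ : ∀ N (xs : List A) (F : Obj h → A → ℕ) →
                  sumClasses≤ h N (λ c → ∑ xs (F c)) ≡ ∑ xs (λ x → sumClasses≤ h N (λ c → F c x))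
  sumClasses≤-∑ N xs F = trans
    (finSum-cong (suc N) (λ k → sumClassesOfSize-∑ (toℕ k) xs F))
    (finSum-∑ (suc N) xs (λ k x → sumClassesOfSize (toℕ k) (λ c → F c x)))

  sumClasses≤-truncate : ∀ M N (w : Obj h → ℕ) → M ≤ N → (∀ k c → M < k → w (k , c) ≡ 0) →
                         sumClasses≤ h N w ≡ sumClasses≤ h M w
  sumClasses≤-truncate M N w M≤N w≗0 = finSum-toℕ-truncate M N (λ m → sumClassesOfSize m w) M≤N
    (λ k M<k → finSum-zero (obj k) (λ c → if-does-zero (isRep? h k c) (λ _ → w≗0 k c M<k)))

  representative : ∀ x → ∃ λ c → x ∼ (proj₁ x , c) × IsRep h (proj₁ x) c
  representative x@(m , u) with ∃-least (λ c → iso? h x (m , c)) (u , ∼-refl)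
  ... | c , x∼c , below = c , x∼c , λ c′ c′<c c′∼c → below c′ c′<c (∼-trans x∼c (∼-sym c′∼c))

  IsRep-unique : ∀ {m c c′} → IsRep h m c → IsRep h m c′ → (m , c) ∼ (m , c′) → c ≡ c′
  IsRep-unique {c = c} {c′} rep rep′ c∼c′ with <-cmp c c′
  ... | tri< c<c′ _ _ = contradiction c∼c′ (rep′ c c<c′)
  ... | tri≈ _ c≡c′ _ = c≡c′
  ... | tri> _ _ c′<c = contradiction (∼-sym c∼c′) (rep c′ c′<c)

  sumClasses≤-χ-∼ : ∀ N (w : Obj h → ℕ) → (∀ {y z} → y ∼ z → w y ≡ w z) → ∀ x → proj₁ x ≤ N →
                    sumClasses≤ h N (λ c → w c * χ (iso? h x c)) ≡ w x
  sumClasses≤-χ-∼ N w w-inv x@(m , _) m≤N = at (representative x)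
    where
    open ≡-Reasoning
    v : Obj h → ℕ
    v c = w c * χ (iso? h x c)

    v-zero : ∀ {c} → ¬ x ∼ c → v c ≡ 0
    v-zero {c} x≁c = trans (cong (w c *_) (χ-no (iso? h x c) x≁c)) (*-zeroʳ (w c))

    other-sizes : ∀ k → k ≢ m → sumClassesOfSize k v ≡ 0
    other-sizes k k≢m = finSum-zero (obj k) (λ c →
      if-does-zero (isRep? h k c) (λ _ → v-zero (λ x∼c → k≢m (sym (∼-size x∼c)))))

    at : (∃ λ c → x ∼ (m , c) × IsRep h m c) → sumClasses≤ h N v ≡ w x
    at (c₀ , x∼c₀ , rep₀) = begin
      sumClasses≤ h N v
        ≡⟨ finSum-toℕ-single (suc N) (λ k → sumClassesOfSize k v) m (s≤s m≤N) other-sizes ⟩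
      sumClassesOfSize m v
        ≡⟨ finSum-single (obj m) (λ c → if does (isRep? h m c) then v (m , c) else 0) c₀ other-classes ⟩
      (if does (isRep? h m c₀) then v (m , c₀) else 0)
        ≡⟨ cong (if_then v (m , c₀) else 0) (dec-true (isRep? h m c₀) rep₀) ⟩
      w (m , c₀) * χ (iso? h x (m , c₀))
        ≡⟨ cong₂ _*_ (w-inv (∼-sym x∼c₀)) (χ-yes (iso? h x (m , c₀)) x∼c₀) ⟩
      w x * 1
        ≡⟨ *-identityʳ (w x) ⟩
      w x ∎
      where
      other-classes : ∀ c → c ≢ c₀ → (if does (isRep? h m c) then v (m , c) else 0) ≡ 0
      other-classes c c≢c₀ = if-does-zero (isRep? h m c) (λ rep →
        v-zero (λ x∼c → c≢c₀ (IsRep-unique rep rep₀ (∼-trans (∼-sym x∼c) x∼c₀))))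

  -- The product formula

  -- Every pair (S , T) is counted once, at U = S ∪ T.
  ∑-covers-allSubsets : ∀ {n} (e : Fin (obj n)) a b IJ →
                        ∑ (allSubsets n) (λ U → χ (covers? U e a b IJ))
                        ≡ χ (iso? h (restrict h (proj₁ IJ) e) a) * χ (iso? h (restrict h (proj₂ IJ) e) b)
  ∑-covers-allSubsets {n} e a b (S , T) = begin
    ∑ Ss (λ U → χ (covers? U e a b (S , T)))
      ≡⟨ ∑-cong Ss (λ U → trans (χ-× (S ∪ T ≟ˢ U ×-dec S?) T?) (cong (_* χ T?) (χ-× (S ∪ T ≟ˢ U) S?))) ⟩
    ∑ Ss (λ U → χ (S ∪ T ≟ˢ U) * χ S? * χ T?)
      ≡⟨ ∑-cong Ss (λ U → trans (*-assoc (χ (S ∪ T ≟ˢ U)) (χ S?) (χ T?))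
                                (cong (_* (χ S? * χ T?)) (χ-⇔ (mk⇔ sym sym) (S ∪ T ≟ˢ U) (U ≟ˢ S ∪ T)))) ⟩
    ∑ Ss (λ U → χ (U ≟ˢ S ∪ T) * (χ S? * χ T?))
      ≡⟨ ∑-*ʳ Ss (χ S? * χ T?) (λ U → χ (U ≟ˢ S ∪ T)) ⟩
    ∑ Ss (λ U → χ (U ≟ˢ S ∪ T)) * (χ S? * χ T?)
      ≡⟨ cong (_* (χ S? * χ T?)) (allSubsets-enumerates n (S ∪ T)) ⟩
    1 * (χ S? * χ T?)
      ≡⟨ *-identityˡ _ ⟩
    χ S? * χ T? ∎
    where
    open ≡-Reasoning
    Ss : List (Subset n)
    Ss = allSubsets n
    S? : Dec (restrict h S e ∼ a)
    S? = iso? h (restrict h S e) a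
    T? : Dec (restrict h T e ∼ b)
    T? = iso? h (restrict h T e) b

  pat-*-pat≡∑-qshuffle : ∀ a b d →
                         pat h a d * pat h b d
                         ≡ ∑ (allSubsets (proj₁ d)) (λ U → qshuffle h (restrict h U (proj₂ d)) a b)
  pat-*-pat≡∑-qshuffle a b (n , e) = begin
    pat h a (n , e) * pat h b (n , e)
      ≡⟨ cong₂ _*_ (length-filter (restrict∼? a) Ss) (length-filter (restrict∼? b) Ss) ⟩
    ∑ Ss (λ S → χ (restrict∼? a S)) * ∑ Ss (λ T → χ (restrict∼? b T))
      ≡⟨ ∑-*-∑ Ss Ss (λ S → χ (restrict∼? a S)) (λ T → χ (restrict∼? b T)) ⟩
    ∑ (pairs n) (λ IJ → χ (restrict∼? a (proj₁ IJ)) * χ (restrict∼? b (proj₂ IJ)))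
      ≡⟨ ∑-cong (pairs n) (∑-covers-allSubsets e a b) ⟨
    ∑ (pairs n) (λ IJ → ∑ Ss (λ U → χ (covers? U e a b IJ)))
      ≡⟨ ∑-swap (pairs n) Ss (λ IJ U → χ (covers? U e a b IJ)) ⟩
    ∑ Ss (λ U → ∑ (pairs n) (λ IJ → χ (covers? U e a b IJ)))
      ≡⟨ ∑-cong Ss (λ U → ∑-covers-restrict U e a b) ⟩
    ∑ Ss (λ U → qshuffle h (restrict h U e) a b) ∎
    where
    open ≡-Reasoning
    Ss : List (Subset n)
    Ss = allSubsets n
    restrict∼? : (c : Obj h) (S : Subset n) → Dec (restrict h S e ∼ c)
    restrict∼? c S = iso? h (restrict h S e) c

  ∑-restrict≡sumClasses≤ : ∀ N (w : Obj h → ℕ) → (∀ {y z} → y ∼ z → w y ≡ w z) → ∀ d → proj₁ d ≤ N →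
                           ∑ (allSubsets (proj₁ d)) (λ U → w (restrict h U (proj₂ d)))
                           ≡ sumClasses≤ h N (λ c → w c * pat h c d)
  ∑-restrict≡sumClasses≤ N w w-inv d@(n , e) n≤N = begin
    ∑ Ss (λ U → w (restrict h U e))
      ≡⟨ ∑-cong Ss (λ U → sumClasses≤-χ-∼ N w w-inv (restrict h U e) (≤-trans (card-≤ U) n≤N)) ⟨
    ∑ Ss (λ U → sumClasses≤ h N (λ c → w c * χ (iso? h (restrict h U e) c)))
      ≡⟨ sumClasses≤-∑ N Ss (λ c U → w c * χ (iso? h (restrict h U e) c)) ⟨
    sumClasses≤ h N (λ c → ∑ Ss (λ U → w c * χ (iso? h (restrict h U e) c)))
      ≡⟨ sumClasses≤-cong N (λ c → trans (∑-*ˡ Ss (w c) (λ U → χ (restrict∼? c U)))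
                                          (cong (w c *_) (sym (length-filter (restrict∼? c) Ss)))) ⟩
    sumClasses≤ h N (λ c → w c * pat h c d) ∎
    where
    open ≡-Reasoning
    Ss : List (Subset n)
    Ss = allSubsets n
    restrict∼? : (c : Obj h) (U : Subset n) → Dec (restrict h U e ∼ c)
    restrict∼? c U = iso? h (restrict h U e) c

  pat-*-pat : ∀ a b d N → proj₁ d ≤ N →
              pat h a d * pat h b d ≡ sumClasses≤ h N (λ c → qshuffle h c a b * pat h c d)
  pat-*-pat a b d N d≤N = trans (pat-*-pat≡∑-qshuffle a b d)
    (∑-restrict≡sumClasses≤ N (λ c → qshuffle h c a b) (qshuffle-∼ a b) d d≤N)

  -- The unit

  finSum-χ-∼-empty : ∀ m y → finSum (obj 0) (λ c → χ (iso? h (m , y) (0 , c))) ≡ χ (m ℕ.≟ 0)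
  finSum-χ-∼-empty zero    y = trans
    (finSum-single (obj 0) _ y (λ c c≢y →
      χ-no (iso? h (0 , y) (0 , c)) (λ y∼c → c≢y (sym (∼-empty y∼c)))))
    (χ-yes (iso? h (0 , y) (0 , y)) ∼-refl)
  finSum-χ-∼-empty (suc m) y =
    finSum-zero (obj 0) (λ c → χ-no (iso? h (suc m , y) (0 , c)) (1+n≢0 ∘ ∼-size))

  finSum-pat-empty : ∀ x → finSum (obj 0) (λ c → pat h (0 , c) x) ≡ 1
  finSum-pat-empty (n , e) = begin
    finSum (obj 0) (λ c → pat h (0 , c) (n , e))
      ≡⟨ finSum-cong (obj 0) (λ c → length-filter (λ S → iso? h (restrict h S e) (0 , c)) Ss) ⟩
    finSum (obj 0) (λ c → ∑ Ss (λ S → χ (iso? h (restrict h S e) (0 , c))))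
      ≡⟨ finSum-∑ (obj 0) Ss (λ c S → χ (iso? h (restrict h S e) (0 , c))) ⟩
    ∑ Ss (λ S → finSum (obj 0) (λ c → χ (iso? h (restrict h S e) (0 , c))))
      ≡⟨ ∑-cong Ss (λ S → finSum-χ-∼-empty (card S) (proj₂ (restrict h S e))) ⟩
    ∑ Ss (λ S → χ (card S ℕ.≟ 0))
      ≡⟨ ∑-χ-card≡0 n ⟩
    1 ∎
    where
    open ≡-Reasoning
    Ss : List (Subset n)
    Ss = allSubsets n

  LinComb : Set
  LinComb = List (ℚ × Obj h)

  evalLC-++ : ∀ (L L′ : LinComb) x → evalLC h (L ++ L′) x ≡ evalLC h L x ℚ.+ evalLC h L′ x
  evalLC-++ []            L′ x = sym (ℚ.+-identityˡ (evalLC h L′ x))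
  evalLC-++ ((q , a) ∷ L) L′ x =
    trans (cong (q ℚ.* patℚ h a x ℚ.+_) (evalLC-++ L L′ x))
          (sym (ℚ.+-assoc (q ℚ.* patℚ h a x) (evalLC h L x) (evalLC h L′ x)))

  scale : ℚ → LinComb → LinComb
  scale q = map (Product.map₁ (q ℚ.*_))

  evalLC-scale : ∀ q (L : LinComb) x → evalLC h (scale q L) x ≡ q ℚ.* evalLC h L x
  evalLC-scale q []            x = sym (ℚ.*-zeroʳ q)
  evalLC-scale q ((r , a) ∷ L) x = begin
    q ℚ.* r ℚ.* patℚ h a x ℚ.+ evalLC h (scale q L) x
      ≡⟨ cong₂ ℚ._+_ (ℚ.*-assoc q r (patℚ h a x)) (evalLC-scale q L x) ⟩
    q ℚ.* (r ℚ.* patℚ h a x) ℚ.+ q ℚ.* evalLC h L x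
      ≡⟨ ℚ.*-distribˡ-+ q (r ℚ.* patℚ h a x) (evalLC h L x) ⟨
    q ℚ.* (r ℚ.* patℚ h a x ℚ.+ evalLC h L x) ∎
    where open ≡-Reasoning

  concatFin : ∀ n → (Fin n → LinComb) → LinComb
  concatFin zero    G = []
  concatFin (suc n) G = G zero ++ concatFin n (G ∘ suc)

  evalLC-concatFin : ∀ n (G : Fin n → LinComb) (W : Fin n → ℕ) x →
                     (∀ i → evalLC h (G i) x ≡ ℕ→ℚ (W i)) →
                     evalLC h (concatFin n G) x ≡ ℕ→ℚ (finSum n W)
  evalLC-concatFin zero    G W x G≗W = refl
  evalLC-concatFin (suc n) G W x G≗W = begin
    evalLC h (G zero ++ concatFin n (G ∘ suc)) x
      ≡⟨ evalLC-++ (G zero) (concatFin n (G ∘ suc)) x ⟩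
    evalLC h (G zero) x ℚ.+ evalLC h (concatFin n (G ∘ suc)) x
      ≡⟨ cong₂ ℚ._+_ (G≗W zero) (evalLC-concatFin n (G ∘ suc) (W ∘ suc) x (G≗W ∘ suc)) ⟩
    ℕ→ℚ (W zero) ℚ.+ ℕ→ℚ (finSum n (W ∘ suc))
      ≡⟨ ℕ→ℚ-+ (W zero) (finSum n (W ∘ suc)) ⟨
    ℕ→ℚ (finSum (suc n) W) ∎
    where open ≡-Reasoning

  evalLC-term : ∀ k a x → evalLC h ((ℕ→ℚ k , a) ∷ []) x ≡ ℕ→ℚ (k * pat h a x)
  evalLC-term k a x = trans (ℚ.+-identityʳ (ℕ→ℚ k ℚ.* patℚ h a x)) (sym (ℕ→ℚ-* k (pat h a x)))

  classTerm : ∀ m → (Obj h → ℕ) → Fin (obj m) → LinComb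
  classTerm m w c = (ℕ→ℚ (if does (isRep? h m c) then w (m , c) else 0) , (m , c)) ∷ []

  evalLC-classTerm : ∀ m w x c →
                     evalLC h (classTerm m w c) x
                     ≡ ℕ→ℚ (if does (isRep? h m c) then w (m , c) * pat h (m , c) x else 0)
  evalLC-classTerm m w x c =
    trans (evalLC-term (if does (isRep? h m c) then w (m , c) else 0) (m , c) x)
          (cong ℕ→ℚ (if-* (does (isRep? h m c)) (w (m , c)) (pat h (m , c) x)))

  classCombination : ℕ → (Obj h → ℕ) → LinComb
  classCombination N w = concatFin (suc N) (λ k → concatFin (obj (toℕ k)) (classTerm (toℕ k) w))

  evalLC-classCombination : ∀ N w x →
                            evalLC h (classCombination N w) x
                            ≡ ℕ→ℚ (sumClasses≤ h N (λ c → w c * pat h c x))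
  evalLC-classCombination N w x =
    evalLC-concatFin (suc N) (λ k → concatFin (obj (toℕ k)) (classTerm (toℕ k) w))
                     (λ k → sumClassesOfSize (toℕ k) (λ c → w c * pat h c x)) x
                     (λ k → evalLC-concatFin (obj (toℕ k)) (classTerm (toℕ k) w) _ x
                                             (evalLC-classTerm (toℕ k) w x))

  patternProduct : Obj h → Obj h → LinComb
  patternProduct a b = classCombination (proj₁ a + proj₁ b) (λ c → qshuffle h c a b)

  -- Quasi-shuffle numbers vanish above |a| + |b|, so pat-*-pat holds with this bound for every x.
  evalLC-patternProduct : ∀ a b x → evalLC h (patternProduct a b) x ≡ patℚ h a x ℚ.* patℚ h b x
  evalLC-patternProduct a b x = begin
    evalLC h (patternProduct a b) x
      ≡⟨ evalLC-classCombination M w x ⟩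
    ℕ→ℚ (sumClasses≤ h M w·p)
      ≡⟨ cong ℕ→ℚ (sumClasses≤-truncate M (proj₁ x + M) w·p (m≤n+m M (proj₁ x)) vanish) ⟨
    ℕ→ℚ (sumClasses≤ h (proj₁ x + M) w·p)
      ≡⟨ cong ℕ→ℚ (pat-*-pat a b x (proj₁ x + M) (m≤m+n (proj₁ x) M)) ⟨
    ℕ→ℚ (pat h a x * pat h b x)
      ≡⟨ ℕ→ℚ-* (pat h a x) (pat h b x) ⟩
    patℚ h a x ℚ.* patℚ h b x ∎
    where
    open ≡-Reasoning
    M : ℕ
    M = proj₁ a + proj₁ b
    w : Obj h → ℕ
    w c = qshuffle h c a b
    w·p : Obj h → ℕ
    w·p c = w c * pat h c x
    vanish : ∀ k c → M < k → w·p (k , c) ≡ 0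
    vanish k c M<k = cong (_* pat h (k , c) x) (qshuffle-vanishes c a b M<k)

  infixr 7 _⊙_ _⊗_

  _⊙_ : Obj h → LinComb → LinComb
  a ⊙ []            = []
  a ⊙ ((r , b) ∷ L) = scale r (patternProduct a b) ++ a ⊙ L

  evalLC-⊙ : ∀ a L x → evalLC h (a ⊙ L) x ≡ patℚ h a x ℚ.* evalLC h L x
  evalLC-⊙ a []            x = sym (ℚ.*-zeroʳ (patℚ h a x))
  evalLC-⊙ a ((r , b) ∷ L) x = begin
    evalLC h (scale r (patternProduct a b) ++ a ⊙ L) x
      ≡⟨ evalLC-++ (scale r (patternProduct a b)) (a ⊙ L) x ⟩
    evalLC h (scale r (patternProduct a b)) x ℚ.+ evalLC h (a ⊙ L) x
      ≡⟨ cong₂ ℚ._+_ (trans (evalLC-scale r (patternProduct a b) x)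
                            (cong (r ℚ.*_) (evalLC-patternProduct a b x)))
                     (evalLC-⊙ a L x) ⟩
    r ℚ.* (pₐ ℚ.* patℚ h b x) ℚ.+ pₐ ℚ.* evalLC h L x
      ≡⟨ cong (ℚ._+ pₐ ℚ.* evalLC h L x) (x∙yz≈y∙xz r pₐ (patℚ h b x)) ⟩
    pₐ ℚ.* (r ℚ.* patℚ h b x) ℚ.+ pₐ ℚ.* evalLC h L x
      ≡⟨ ℚ.*-distribˡ-+ pₐ (r ℚ.* patℚ h b x) (evalLC h L x) ⟨
    pₐ ℚ.* (r ℚ.* patℚ h b x ℚ.+ evalLC h L x) ∎
    where
    open ≡-Reasoning
    pₐ : ℚ
    pₐ = patℚ h a x

  _⊗_ : LinComb → LinComb → LinComb
  []            ⊗ L′ = []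
  ((q , a) ∷ L) ⊗ L′ = scale q (a ⊙ L′) ++ L ⊗ L′

  evalLC-⊗ : ∀ L L′ x → evalLC h (L ⊗ L′) x ≡ evalLC h L x ℚ.* evalLC h L′ x
  evalLC-⊗ []            L′ x = sym (ℚ.*-zeroˡ (evalLC h L′ x))
  evalLC-⊗ ((q , a) ∷ L) L′ x = begin
    evalLC h (scale q (a ⊙ L′) ++ L ⊗ L′) x
      ≡⟨ evalLC-++ (scale q (a ⊙ L′)) (L ⊗ L′) x ⟩
    evalLC h (scale q (a ⊙ L′)) x ℚ.+ evalLC h (L ⊗ L′) x
      ≡⟨ cong₂ ℚ._+_ (trans (evalLC-scale q (a ⊙ L′) x) (cong (q ℚ.*_) (evalLC-⊙ a L′ x)))
                     (evalLC-⊗ L L′ x) ⟩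
    q ℚ.* (patℚ h a x ℚ.* E′) ℚ.+ evalLC h L x ℚ.* E′
      ≡⟨ cong (ℚ._+ evalLC h L x ℚ.* E′) (ℚ.*-assoc q (patℚ h a x) E′) ⟨
    q ℚ.* patℚ h a x ℚ.* E′ ℚ.+ evalLC h L x ℚ.* E′
      ≡⟨ ℚ.*-distribʳ-+ E′ (q ℚ.* patℚ h a x) (evalLC h L x) ⟨
    (q ℚ.* patℚ h a x ℚ.+ evalLC h L x) ℚ.* E′ ∎
    where
    open ≡-Reasoning
    E′ : ℚ
    E′ = evalLC h L′ x

  InA-* : ∀ (F G : Obj h → ℚ) → InA h F → InA h G → InA h (λ x → F x ℚ.* G x)
  InA-* F G (L , F≗L) (L′ , G≗L′) =
    L ⊗ L′ , λ x → trans (cong₂ ℚ._*_ (F≗L x) (G≗L′ x)) (sym (evalLC-⊗ L L′ x))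

  InA-1 : InA h (λ _ → 1ℚ)
  InA-1 = concatFin (obj 0) (λ c → (ℕ→ℚ 1 , (0 , c)) ∷ []) , λ x → sym (begin
    evalLC h (concatFin (obj 0) (λ c → (ℕ→ℚ 1 , (0 , c)) ∷ [])) x
      ≡⟨ evalLC-concatFin (obj 0) (λ c → (ℕ→ℚ 1 , (0 , c)) ∷ []) (λ c → 1 * pat h (0 , c) x) x
                          (λ c → evalLC-term 1 (0 , c) x) ⟩
    ℕ→ℚ (finSum (obj 0) (λ c → 1 * pat h (0 , c) x))
      ≡⟨ cong ℕ→ℚ (trans (finSum-cong (obj 0) (λ c → *-identityˡ _)) (finSum-pat-empty x)) ⟩
    1ℚ ∎)
    where open ≡-Reasoning

mainTheorem2 : (h : Presheaf) →
    (∀ (a b d : Obj h) (N : ℕ) → proj₁ d ≤ N →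
      pat h a d * pat h b d ≡ sumClasses≤ h N (λ c → qshuffle h c a b * pat h c d))
    × (∀ (F G : Obj h → ℚ.ℚ) → InA h F → InA h G → InA h (λ x → F x ℚ.* G x))
    × InA h (λ _ → 1ℚ)
    × (∀ (x : Obj h) → 1ℚ ≡ ℕ→ℚ (finSum (Presheaf.obj h 0) (λ c → pat h (0 , c) x)))
mainTheorem2 h = pat-*-pat h , InA-* h , InA-1 h , λ x → cong ℕ→ℚ (sym (finSum-pat-empty h x))
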